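{- Let $n\ge 1$ be an integer and let $f:\Delta_n(O,X,Y,Z)\to\mathbb{R}$ be a polarized function, where $\Delta_n(O,X,Y,Z)=\{(x,y,z)\in\mathbb{Z}^3: x,y,z\ge 0,\ x+y+z\le n\}$. Suppose that the restriction of $f$ to the ground face (the function $(x,y)\mapsto f(x,y,0)$ on $\{x,y\ge 0,\ x+y\le n\}$) and the restriction of $f$ to the ceiling face (the function $(x,y)\mapsto f(x,y,n-x-y)$ on $\{x,y\ge 0,\ x+y\le n\}$) are both two-dimensional discretely concave. Then $f\in PCPM_n$, i.e. $f$ is a polarized discretely concave function on $\Delta_n(O,X,Y,Z)$.
   Context: Let $e_1,e_2,e_3$ be the standard basis of $\mathbb{Z}^3$. A unitary octahedron is a set of six lattice points $\{v+e_1,\ v+e_2,\ v+e_3,\ v+e_1+e_2,\ v+e_1+e_3,\ v+e_2+e_3\}$ for some $v\in\mathbb{Z}^3$; its three pairs of antipodal vertices are $\{v+e_1,v+e_2+e_3\}$, $\{v+e_2,v+e_1+e_3\}$ and $\{v+e_3,v+e_1+e_2\}$, the last pair being called the main diagonal. A function $f$ on $\Delta_n(O,X,Y,Z)$ is polarized if for every unitary octahedron all of whose vertices lie in $\Delta_n(O,X,Y,Z)$, $f(v+e_3)+f(v+e_1+e_2)=\max\big(f(v+e_1)+f(v+e_2+e_3),\ f(v+e_2)+f(v+e_1+e_3)\big)$. A function $g$ defined on a set $S\subseteq\mathbb{Z}^2$ is two-dimensional discretely concave if the following three rhombus inequalities hold for all integers $i,j$ for which all four points involved lie in $S$: (i)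 $g(i,j)+g(i+1,j+1)\le g(i+1,j)+g(i,j+1)$; (ii) $g(i+1,j)+g(i+1,j+1)\ge g(i,j+1)+g(i+2,j)$; (iii) $g(i,j+1)+g(i+1,j+1)\ge g(i,j+2)+g(i+1,j)$. (Equivalently, the piecewise-linear interpolation of $g$ over the triangulation cut out by the lines $x=\mathrm{const}$, $y=\mathrm{const}$, $x+y=\mathrm{const}$ (integer constants) is concave, when $S$ is a lattice triangle of this form.) $PCPM_n$ is the set of functions $f$ on $\Delta_n(O,X,Y,Z)$ that are polarized and satisfy all rhombus inequalities in all cutting planes, i.e. for every integer $c$ each of the following functions is two-dimensional discretely concave on the set of points where it is defined (points of $\Delta_n(O,X,Y,Z)$ in the corresponding plane): $(x,y)\mapsto f(x,y,c)$ (plane $z=c$), $(y,z)\mapsto f(c,y,z)$ (plane $x=c$), $(x,z)\mapsto f(x,c,z)$ (plane $y=c$), and $(x,y)\mapsto f(x,y,c-x-y)$ (plane $x+y+z=c$). -}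

module Defs where

open import Level using (0ℓ)
open import Data.Nat using (ℕ)
open import Data.Integer using (ℤ; +_; _+_; _-_; _≤_)
open import Data.Product using (_×_)
open import Data.Sum using (_⊎_)
open import Relation.Binary.PropositionalEquality using (_≡_)

-- A linearly (totally) ordered abelian group.  The real numbers (ℝ, +, ≤)
-- are one; stdlib has no reals, so the value domain is generalised to this.
record LinOrdAbGroup : Set₁ where
  infixl 6 _⊕_
  infix 4 _≼_
  field
    G        : Set
    _⊕_      : G → G → G
    𝟘        : G
    ⊖_       : G → G
    ⊕-assoc  : ∀ a b c → (a ⊕ b) ⊕ c ≡ a ⊕ (b ⊕ c)
    ⊕-comm   : ∀ a b → a ⊕ b ≡ b ⊕ a
    ⊕-idˡ    : ∀ a → 𝟘 ⊕ a ≡ a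
    ⊕-invˡ   : ∀ a → (⊖ a) ⊕ a ≡ 𝟘
    _≼_      : G → G → Set
    ≼-refl   : ∀ a → a ≼ a
    ≼-trans  : ∀ {a b c} → a ≼ b → b ≼ c → a ≼ c
    ≼-antisym : ∀ {a b} → a ≼ b → b ≼ a → a ≡ b
    ≼-total  : ∀ a b → a ≼ b ⊎ b ≼ a
    ⊕-monoˡ-≼ : ∀ {a b} c → a ≼ b → a ⊕ c ≼ b ⊕ c

module _ (R : LinOrdAbGroup) where
  open LinOrdAbGroup R

  IsMax : G → G → G → Set
  IsMax a b c = (b ≼ a) × (c ≼ a) × (a ≡ b ⊎ a ≡ c)

  InΔ : ℕ → ℤ → ℤ → ℤ → Set
  InΔ n x y z = (+ 0 ≤ x) × (+ 0 ≤ y) × (+ 0 ≤ z) × (x + y + z ≤ + n)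

  -- functions on Δ_n are represented as functions on ℤ³ whose values
  -- outside Δ_n are irrelevant (all conditions are restricted to Δ_n).

  -- polarized: for every unitary octahedron (base point v = (a,b,c))
  -- with all six vertices in Δ_n, the main-diagonal sum is the max.
  Polarized : ℕ → (ℤ → ℤ → ℤ → G) → Set
  Polarized n f = ∀ a b c →
    InΔ n (a + + 1) b c → InΔ n a (b + + 1) c → InΔ n a b (c + + 1) →
    InΔ n (a + + 1) (b + + 1) c → InΔ n (a + + 1) b (c + + 1) →
    InΔ n a (b + + 1) (c + + 1) →
    IsMax (f a b (c + + 1) ⊕ f (a + + 1) (b + + 1) c)
          (f (a + + 1) b c ⊕ f a (b + + 1) (c + + 1))
          (f a (b + + 1) c ⊕ f (a + + 1) b (c + + 1))

  DConcave2 : (ℤ → ℤ → Set) → (ℤ → ℤ → G) → Set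
  DConcave2 S g =
    (∀ i j → S i j → S (i + + 1) (j + + 1) → S (i + + 1) j → S i (j + + 1) →
       g i j ⊕ g (i + + 1) (j + + 1) ≼ g (i + + 1) j ⊕ g i (j + + 1))
    × (∀ i j → S (i + + 1) j → S (i + + 1) (j + + 1) → S i (j + + 1) → S (i + + 2) j →
       g i (j + + 1) ⊕ g (i + + 2) j ≼ g (i + + 1) j ⊕ g (i + + 1) (j + + 1))
    × (∀ i j → S i (j + + 1) → S (i + + 1) (j + + 1) → S i (j + + 2) → S (i + + 1) j →
       g i (j + + 2) ⊕ g (i + + 1) j ≼ g i (j + + 1) ⊕ g (i + + 1) (j + + 1))

  AllPlanesConcave : ℕ → (ℤ → ℤ → ℤ → G) → Set
  AllPlanesConcave n f = ∀ c →
      DConcave2 (λ x y → InΔ n x y c) (λ x y → f x y c)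
    × DConcave2 (λ y z → InΔ n c y z) (λ y z → f c y z)
    × DConcave2 (λ x z → InΔ n x c z) (λ x z → f x c z)
    × DConcave2 (λ x y → InΔ n x y (c - x - y)) (λ x y → f x y (c - x - y))

  PCPM : ℕ → (ℤ → ℤ → ℤ → G) → Set
  PCPM n f = Polarized n f × AllPlanesConcave n f

  GroundConcave : ℕ → (ℤ → ℤ → ℤ → G) → Set
  GroundConcave n f = DConcave2 (λ x y → InΔ n x y (+ 0)) (λ x y → f x y (+ 0))

  CeilingConcave : ℕ → (ℤ → ℤ → ℤ → G) → Set
  CeilingConcave n f =
    DConcave2 (λ x y → InΔ n x y (+ n - x - y)) (λ x y → f x y (+ n - x - y))

module Submission where

-- In barycentric coordinates (x, y, z, w), w = n − x − y − z, every cutting plane fixes one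
-- coordinate, and its rhombus inequalities read f(b+2A) + f(b+B+C) ≤ f(b+A+B) + f(b+A+C) for
-- distinct unit steps A, B, C among X, Y, Z, W. Such an inequality, like a comparison of two
-- antipodal sums of the unit octahedron at b, says that a slope f(p+A) − f(p+B) does not
-- decrease along some step, so rhombi and octahedra chain by transitivity. Polarization makes
-- the main antipodal sum the larger one. Hence the rhombus (X; Z, W) at b follows from
-- (X; Z, Y) or from (X; W, Y) at b, according to which other sum equals the main one, while
-- (X; Z, Y) at b + W and (X; W, Y) at b + Z follow from (X; Z, W) at b + Y and the octahedron
-- at b + X; descending in w and z ends at the ceiling w = 0 and the ground z = 0. Similarly
-- (Z; X, Y) at b + W follows from (Z; X, W) at b + Y or (Z; Y, W) at b + X, both consequences
-- of (Z; X, Y), and descends to the ceiling. The apexes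
-- Y and W follow from X and Z by the symmetries x ↔ y and z ↔ w of the hypotheses.

open import Defs
open import Data.Nat using (ℕ; zero; suc; _≥_)
open import Data.Integer using (ℤ)
open import Data.Product using (_×_; _,_; proj₁; proj₂)
open import Data.Sum using (_⊎_; inj₁; inj₂)
open import Relation.Binary.PropositionalEquality
open import Function using (_∘_; id; _⇔_; mk⇔; Equivalence)

module OrderedGroupProperties (R : LinOrdAbGroup) where
  open LinOrdAbGroup R
  open ≡-Reasoning

  infixl 6 _−_
  _−_ : G → G → G
  a − b = a ⊕ ⊖ b

  −⊕-cancel : ∀ a b c → (a − b) ⊕ (b ⊕ c) ≡ a ⊕ c
  −⊕-cancel a b c = begin
    (a ⊕ ⊖ b) ⊕ (b ⊕ c)  ≡⟨ ⊕-assoc a (⊖ b) (b ⊕ c) ⟩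
    a ⊕ (⊖ b ⊕ (b ⊕ c))  ≡⟨ cong (a ⊕_) (sym (⊕-assoc (⊖ b) b c)) ⟩
    a ⊕ ((⊖ b ⊕ b) ⊕ c)  ≡⟨ cong (λ t → a ⊕ (t ⊕ c)) (⊕-invˡ b) ⟩
    a ⊕ (𝟘 ⊕ c)          ≡⟨ cong (a ⊕_) (⊕-idˡ c) ⟩
    a ⊕ c                ∎

  ⊕−-cancel : ∀ a b → (a ⊕ b) − b ≡ a
  ⊕−-cancel a b = begin
    (a ⊕ b) ⊕ ⊖ b  ≡⟨ ⊕-assoc a b (⊖ b) ⟩
    a ⊕ (b ⊕ ⊖ b)  ≡⟨ cong (a ⊕_) (trans (⊕-comm b (⊖ b)) (⊕-invˡ b)) ⟩
    a ⊕ 𝟘          ≡⟨ trans (⊕-comm a 𝟘) (⊕-idˡ a) ⟩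
    a              ∎

  ⊕-cancelʳ-≼ : ∀ {a b} c → a ⊕ c ≼ b ⊕ c → a ≼ b
  ⊕-cancelʳ-≼ {a} {b} c p = subst₂ _≼_ (⊕−-cancel a c) (⊕−-cancel b c) (⊕-monoˡ-≼ (⊖ c) p)

  private
    −⊕-cancel-swap : ∀ c d b → (c − d) ⊕ (b ⊕ d) ≡ b ⊕ c
    −⊕-cancel-swap c d b = trans (cong ((c − d) ⊕_) (⊕-comm b d)) (trans (−⊕-cancel c d b) (⊕-comm c b))

  −≼−⇒⊕≼⊕ : ∀ {a b c d} → a − b ≼ c − d → a ⊕ d ≼ b ⊕ c
  −≼−⇒⊕≼⊕ {a} {b} {c} {d} p =
    subst₂ _≼_ (−⊕-cancel a b d) (−⊕-cancel-swap c d b) (⊕-monoˡ-≼ (b ⊕ d) p)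

  ⊕≼⊕⇒−≼− : ∀ {a b c d} → a ⊕ d ≼ b ⊕ c → a − b ≼ c − d
  ⊕≼⊕⇒−≼− {a} {b} {c} {d} p =
    ⊕-cancelʳ-≼ (b ⊕ d) (subst₂ _≼_ (sym (−⊕-cancel a b d)) (sym (−⊕-cancel-swap c d b)) p)

  −≼−-exchange : ∀ {a b c d} → a − b ≼ c − d → a − c ≼ b − d
  −≼−-exchange {a} {b} {c} {d} p = ⊕≼⊕⇒−≼− (subst (a ⊕ d ≼_) (⊕-comm b c) (−≼−⇒⊕≼⊕ p))

  −≼−-reverse : ∀ {a b c d} → a − b ≼ c − d → d − c ≼ b − a
  −≼−-reverse {a} {b} {c} {d} p = ⊕≼⊕⇒−≼− (subst₂ _≼_ (⊕-comm a d) (⊕-comm b c) (−≼−⇒⊕≼⊕ p))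

  ⊕≼⊕-cong : ∀ {a b c d a′ b′ c′ d′} → a ≡ a′ → b ≡ b′ → c ≡ c′ → d ≡ d′ →
             a ⊕ b ≼ c ⊕ d → a′ ⊕ b′ ≼ c′ ⊕ d′
  ⊕≼⊕-cong refl refl refl refl p = p

  ⊕≼⊕-cong⇔ : ∀ {a b c d a′ b′ c′ d′} → a ≡ a′ → b ≡ b′ → c ≡ c′ → d ≡ d′ →
              (a ⊕ b ≼ c ⊕ d) ⇔ (a′ ⊕ b′ ≼ c′ ⊕ d′)
  ⊕≼⊕-cong⇔ refl refl refl refl = mk⇔ id id

  ⊕≼-swap : ∀ {a b c} → a ⊕ b ≼ c → b ⊕ a ≼ c
  ⊕≼-swap {a} {b} {c} = subst (_≼ c) (⊕-comm a b)

  ⊕≼⊕-swap-cong⇔ : ∀ {a b c d a′ b′ c′ d′} → a ≡ b′ → b ≡ a′ → c ≡ c′ → d ≡ d′ →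
                   (a ⊕ b ≼ c ⊕ d) ⇔ (a′ ⊕ b′ ≼ c′ ⊕ d′)
  ⊕≼⊕-swap-cong⇔ refl refl refl refl = mk⇔ ⊕≼-swap ⊕≼-swap

  IsMax-attained : ∀ {a b c} → IsMax R a b c → a ≼ b ⊎ a ≼ c
  IsMax-attained {a} (_ , _ , inj₁ a≡b) = inj₁ (subst (a ≼_) a≡b (≼-refl a))
  IsMax-attained {a} (_ , _ , inj₂ a≡c) = inj₂ (subst (a ≼_) a≡c (≼-refl a))

  IsMax-comm : ∀ {a b c} → IsMax R a b c → IsMax R a c b
  IsMax-comm (b≼a , c≼a , inj₁ a≡b) = c≼a , b≼a , inj₂ a≡b
  IsMax-comm (b≼a , c≼a , inj₂ a≡c) = c≼a , b≼a , inj₁ a≡c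

  IsMax-cong : ∀ {a b c a′ b′ c′} → a ≡ a′ → b ≡ b′ → c ≡ c′ → IsMax R a b c → IsMax R a′ b′ c′
  IsMax-cong refl refl refl m = m

module Barycentric where
  open import Data.Nat using (_+_)
  open import Data.Nat.Properties using (+-suc; +-comm; +-assoc)

  data Dir : Set where
    X Y Z W : Dir

  -- A lattice point of Δ_n with its fourth barycentric coordinate w = n − x − y − z.
  record Point : Set where
    constructor ⟨_,_,_,_⟩
    field
      x y z w : ℕ

  infixl 6 _⊹_
  _⊹_ : Point → Dir → Point
  ⟨ x , y , z , w ⟩ ⊹ X = ⟨ suc x , y , z , w ⟩
  ⟨ x , y , z , w ⟩ ⊹ Y = ⟨ x , suc y , z , w ⟩
  ⟨ x , y , z , w ⟩ ⊹ Z = ⟨ x , y , suc z , w ⟩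
  ⟨ x , y , z , w ⟩ ⊹ W = ⟨ x , y , z , suc w ⟩

  size : Point → ℕ
  size ⟨ x , y , z , w ⟩ = x + y + z + w

  size-⊹ : ∀ p A → size (p ⊹ A) ≡ suc (size p)
  size-⊹ ⟨ x , y , z , w ⟩ X = refl
  size-⊹ ⟨ x , y , z , w ⟩ Y = cong (λ t → t + z + w) (+-suc x y)
  size-⊹ ⟨ x , y , z , w ⟩ Z = cong (_+ w) (+-suc (x + y) z)
  size-⊹ ⟨ x , y , z , w ⟩ W = +-suc (x + y + z) w

  size-⊹⊹ : ∀ p A B → size (p ⊹ A ⊹ B) ≡ 2 + size p
  size-⊹⊹ p A B = trans (size-⊹ (p ⊹ A) B) (cong suc (size-⊹ p A))

  -- All the points b ⊹ A ⊹ B lie in Δ_n.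
  IsBase : ℕ → Point → Set
  IsBase n b = 2 + size b ≡ n

  IsBase-move : ∀ {n} p A B → IsBase n (p ⊹ A) → IsBase n (p ⊹ B)
  IsBase-move p A B e = trans (cong (2 +_) (trans (size-⊹ p B) (sym (size-⊹ p A)))) e

  swapXY swapZW : Point → Point
  swapXY ⟨ x , y , z , w ⟩ = ⟨ y , x , z , w ⟩
  swapZW ⟨ x , y , z , w ⟩ = ⟨ x , y , w , z ⟩

  IsBase-swapXY : ∀ {n} b → IsBase n b → IsBase n (swapXY b)
  IsBase-swapXY ⟨ x , y , z , w ⟩ = trans (cong (λ t → 2 + (t + z + w)) (+-comm y x))

  IsBase-swapZW : ∀ {n} b → IsBase n b → IsBase n (swapZW b)
  IsBase-swapZW ⟨ x , y , z , w ⟩ = trans (cong (2 +_) (trans (+-assoc (x + y) w z)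
    (trans (cong (x + y +_) (+-comm w z)) (sym (+-assoc (x + y) z w)))))

open Barycentric

module Rhombi (R : LinOrdAbGroup) where
  open LinOrdAbGroup R
  open OrderedGroupProperties R

  -- v A B is the value at b ⊹ A ⊹ B; for A ≠ B these are the vertices of the unit octahedron
  -- with base b, and its main diagonal joins b ⊹ Z ⊹ W and b ⊹ X ⊹ Y.
  MainDiagonalMax : (Dir → Dir → G) → Set
  MainDiagonalMax v = IsMax R (v Z W ⊕ v X Y) (v X W ⊕ v Y Z) (v Y W ⊕ v X Z)

  MainDiagonalMax-cong : ∀ {v v′} → (∀ A B → v A B ≡ v′ A B) → MainDiagonalMax v → MainDiagonalMax v′
  MainDiagonalMax-cong e =
    IsMax-cong (cong₂ _⊕_ (e Z W) (e X Y)) (cong₂ _⊕_ (e X W) (e Y Z)) (cong₂ _⊕_ (e Y W) (e X Z))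

  module _ (F : Point → G) where

    PolarizedAt : Point → Set
    PolarizedAt b = MainDiagonalMax (λ A B → F (b ⊹ A ⊹ B))

    slope : Dir → Dir → Point → G
    slope A B p = F (p ⊹ A) − F (p ⊹ B)

    Rhombus : Dir → Dir → Dir → Point → Set
    Rhombus A B C b = slope A B (b ⊹ A) ≼ slope A B (b ⊹ C)

  module ApexX (n : ℕ) (F : Point → G)
    (polarized : ∀ b → IsBase n b → PolarizedAt F b)
    (ceiling : ∀ i j k → IsBase n ⟨ i , j , k , 0 ⟩ → Rhombus F X Z Y ⟨ i , j , k , 0 ⟩)
    (ground : ∀ i j l → IsBase n ⟨ i , j , 0 , l ⟩ → Rhombus F X W Y ⟨ i , j , 0 , l ⟩) where

    rhombus-XZW : ∀ i j k l → IsBase n ⟨ i , j , k , l ⟩ → Rhombus F X Z W ⟨ i , j , k , l ⟩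
    rhombus-XZY : ∀ i j k l → IsBase n ⟨ i , j , k , l ⟩ → Rhombus F X Z Y ⟨ i , j , k , l ⟩
    rhombus-XWY : ∀ i j k l → IsBase n ⟨ i , j , k , l ⟩ → Rhombus F X W Y ⟨ i , j , k , l ⟩

    rhombus-XZW i j k l e with IsMax-attained (polarized _ e)
    ... | inj₁ main≼XW = ≼-trans (rhombus-XZY i j k l e) (−≼−-reverse (⊕≼⊕⇒−≼− main≼XW))
    ... | inj₂ main≼YW =
      −≼−-exchange (≼-trans (rhombus-XWY i j k l e) (−≼−-exchange (−≼−-reverse (⊕≼⊕⇒−≼− main≼YW))))

    rhombus-XZY i j k zero e = ceiling i j k e
    rhombus-XZY i j k (suc l) e =
      ≼-trans (⊕≼⊕⇒−≼− (proj₁ (polarized (c ⊹ X) (IsBase-move c W X e))))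
              (rhombus-XZW i (suc j) k l (IsBase-move c W Y e))
      where
      c : Point
      c = ⟨ i , j , k , l ⟩

    rhombus-XWY i j zero l e = ground i j l e
    rhombus-XWY i j (suc k) l e =
      ≼-trans (−≼−-exchange (−≼−-reverse
                 (⊕≼⊕⇒−≼− (proj₁ (proj₂ (polarized (c ⊹ X) (IsBase-move c Z X e)))))))
              (−≼−-exchange (rhombus-XZW i (suc j) k l (IsBase-move c Z Y e)))
      where
      c : Point
      c = ⟨ i , j , k , l ⟩

  module ApexZ (n : ℕ) (F : Point → G)
    (polarized : ∀ b → IsBase n b → PolarizedAt F b)
    (ceiling : ∀ i j k → IsBase n ⟨ i , j , k , 0 ⟩ → Rhombus F Z X Y ⟨ i , j , k , 0 ⟩) where

    rhombus-ZXY : ∀ i j k l → IsBase n ⟨ i , j , k , l ⟩ → Rhombus F Z X Y ⟨ i , j , k , l ⟩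
    rhombus-ZXW : ∀ i j k l → IsBase n ⟨ i , j , k , l ⟩ → Rhombus F Z X W ⟨ i , j , k , l ⟩
    rhombus-ZYW : ∀ i j k l → IsBase n ⟨ i , j , k , l ⟩ → Rhombus F Z Y W ⟨ i , j , k , l ⟩

    rhombus-ZXY i j k zero e = ceiling i j k e
    rhombus-ZXY i j k (suc l) e
      with IsMax-attained (polarized (⟨ i , j , k , l ⟩ ⊹ Z) (IsBase-move ⟨ i , j , k , l ⟩ W Z e))
    ... | inj₁ main≼XW =
      ≼-trans (⊕≼⊕⇒−≼− main≼XW) (rhombus-ZXW i (suc j) k l (IsBase-move ⟨ i , j , k , l ⟩ W Y e))
    ... | inj₂ main≼YW =
      −≼−-exchange
        (≼-trans (⊕≼⊕⇒−≼− main≼YW) (rhombus-ZYW (suc i) j k l (IsBase-move ⟨ i , j , k , l ⟩ W X e)))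

    rhombus-ZXW i j k l e =
      ≼-trans (rhombus-ZXY i j k l e) (−≼−-reverse (⊕≼⊕⇒−≼− (proj₁ (polarized _ e))))

    rhombus-ZYW i j k l e =
      ≼-trans (−≼−-exchange (rhombus-ZXY i j k l e)) (−≼−-reverse (⊕≼⊕⇒−≼− (proj₁ (proj₂ (polarized _ e)))))

  module Concavity (n : ℕ) (F : Point → G)
    (polarized : ∀ b → IsBase n b → PolarizedAt F b)
    (ground : ∀ i j l → IsBase n ⟨ i , j , 0 , l ⟩ →
      Rhombus F W X Y ⟨ i , j , 0 , l ⟩ × Rhombus F X W Y ⟨ i , j , 0 , l ⟩ ×
      Rhombus F Y W X ⟨ i , j , 0 , l ⟩)
    (ceiling : ∀ i j k → IsBase n ⟨ i , j , k , 0 ⟩ →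
      Rhombus F Z X Y ⟨ i , j , k , 0 ⟩ × Rhombus F X Z Y ⟨ i , j , k , 0 ⟩ ×
      Rhombus F Y Z X ⟨ i , j , k , 0 ⟩)
    where

    -- Rhombus (F ∘ swapXY) A B C b is definitionally the rhombus of F at swapXY b with X and Y
    -- exchanged in A, B, C; likewise for swapZW.
    private
      F∘swapXY F∘swapZW : Point → G
      F∘swapXY p = F (swapXY p)
      F∘swapZW p = F (swapZW p)

      polarized-swapXY : ∀ b → IsBase n b → PolarizedAt F∘swapXY b
      polarized-swapXY b e = IsMax-comm (polarized (swapXY b) (IsBase-swapXY b e))

      polarized-swapZW : ∀ b → IsBase n b → PolarizedAt F∘swapZW b
      polarized-swapZW b e =
        IsMax-cong refl (⊕-comm _ _) (⊕-comm _ _) (IsMax-comm (polarized (swapZW b) (IsBase-swapZW b e)))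

      ceiling-XZY : ∀ i j k → IsBase n ⟨ i , j , k , 0 ⟩ → Rhombus F X Z Y ⟨ i , j , k , 0 ⟩
      ceiling-XZY i j k e = proj₁ (proj₂ (ceiling i j k e))

      ceiling-YZX : ∀ i j k → IsBase n ⟨ i , j , k , 0 ⟩ → Rhombus F Y Z X ⟨ j , i , k , 0 ⟩
      ceiling-YZX i j k e = proj₂ (proj₂ (ceiling j i k (IsBase-swapXY ⟨ i , j , k , 0 ⟩ e)))

      ground-XWY : ∀ i j l → IsBase n ⟨ i , j , 0 , l ⟩ → Rhombus F X W Y ⟨ i , j , 0 , l ⟩
      ground-XWY i j l e = proj₁ (proj₂ (ground i j l e))

      ground-YWX : ∀ i j l → IsBase n ⟨ i , j , 0 , l ⟩ → Rhombus F Y W X ⟨ j , i , 0 , l ⟩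
      ground-YWX i j l e = proj₂ (proj₂ (ground j i l (IsBase-swapXY ⟨ i , j , 0 , l ⟩ e)))

      ceiling-ZXY : ∀ i j k → IsBase n ⟨ i , j , k , 0 ⟩ → Rhombus F Z X Y ⟨ i , j , k , 0 ⟩
      ceiling-ZXY i j k e = proj₁ (ceiling i j k e)

      ground-WXY : ∀ i j k → IsBase n ⟨ i , j , k , 0 ⟩ → Rhombus F W X Y ⟨ i , j , 0 , k ⟩
      ground-WXY i j k e = proj₁ (ground i j k (IsBase-swapZW ⟨ i , j , k , 0 ⟩ e))

      module AX = ApexX n F polarized ceiling-XZY ground-XWY
      module AY = ApexX n F∘swapXY polarized-swapXY ceiling-YZX ground-YWX
      module AZ = ApexZ n F polarized ceiling-ZXY
      module AW = ApexZ n F∘swapZW polarized-swapZW ground-WXY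

    rhombus-XZW : ∀ b → IsBase n b → Rhombus F X Z W b
    rhombus-XZW ⟨ i , j , k , l ⟩ = AX.rhombus-XZW i j k l
    rhombus-XZY : ∀ b → IsBase n b → Rhombus F X Z Y b
    rhombus-XZY ⟨ i , j , k , l ⟩ = AX.rhombus-XZY i j k l
    rhombus-XWY : ∀ b → IsBase n b → Rhombus F X W Y b
    rhombus-XWY ⟨ i , j , k , l ⟩ = AX.rhombus-XWY i j k l
    rhombus-YZW : ∀ b → IsBase n b → Rhombus F Y Z W b
    rhombus-YZW b@(⟨ i , j , k , l ⟩) e = AY.rhombus-XZW j i k l (IsBase-swapXY b e)
    rhombus-YZX : ∀ b → IsBase n b → Rhombus F Y Z X b
    rhombus-YZX b@(⟨ i , j , k , l ⟩) e = AY.rhombus-XZY j i k l (IsBase-swapXY b e)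
    rhombus-YWX : ∀ b → IsBase n b → Rhombus F Y W X b
    rhombus-YWX b@(⟨ i , j , k , l ⟩) e = AY.rhombus-XWY j i k l (IsBase-swapXY b e)
    rhombus-ZXY : ∀ b → IsBase n b → Rhombus F Z X Y b
    rhombus-ZXY ⟨ i , j , k , l ⟩ = AZ.rhombus-ZXY i j k l
    rhombus-ZXW : ∀ b → IsBase n b → Rhombus F Z X W b
    rhombus-ZXW ⟨ i , j , k , l ⟩ = AZ.rhombus-ZXW i j k l
    rhombus-ZYW : ∀ b → IsBase n b → Rhombus F Z Y W b
    rhombus-ZYW ⟨ i , j , k , l ⟩ = AZ.rhombus-ZYW i j k l
    rhombus-WXY : ∀ b → IsBase n b → Rhombus F W X Y b
    rhombus-WXY b@(⟨ i , j , k , l ⟩) e = AW.rhombus-ZXY i j l k (IsBase-swapZW b e)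
    rhombus-WXZ : ∀ b → IsBase n b → Rhombus F W X Z b
    rhombus-WXZ b@(⟨ i , j , k , l ⟩) e = AW.rhombus-ZXW i j l k (IsBase-swapZW b e)
    rhombus-WYZ : ∀ b → IsBase n b → Rhombus F W Y Z b
    rhombus-WYZ b@(⟨ i , j , k , l ⟩) e = AW.rhombus-ZYW i j l k (IsBase-swapZW b e)

    rhombus-XWZ : ∀ b → IsBase n b → Rhombus F X W Z b
    rhombus-XWZ b e = −≼−-exchange (rhombus-XZW b e)
    rhombus-YWZ : ∀ b → IsBase n b → Rhombus F Y W Z b
    rhombus-YWZ b e = −≼−-exchange (rhombus-YZW b e)
    rhombus-ZWX : ∀ b → IsBase n b → Rhombus F Z W X b
    rhombus-ZWX b e = −≼−-exchange (rhombus-ZXW b e)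
    rhombus-ZWY : ∀ b → IsBase n b → Rhombus F Z W Y b
    rhombus-ZWY b e = −≼−-exchange (rhombus-ZYW b e)

module IntegerCoordinates where
  open import Data.Integer using (+_; _+_)
  open import Data.Nat.Properties using (+-comm)

  -- In ℤ³ the coordinate w is implicit, so the step W is the zero vector.
  Pointℤ : Set
  Pointℤ = ℤ × ℤ × ℤ

  infixl 6 _⊹ᶻ_ _⊹²_
  _⊹ᶻ_ : Pointℤ → Dir → Pointℤ
  (x , y , z) ⊹ᶻ X = (x + + 1 , y , z)
  (x , y , z) ⊹ᶻ Y = (x , y + + 1 , z)
  (x , y , z) ⊹ᶻ Z = (x , y , z + + 1)
  β ⊹ᶻ W = β

  _⊹²_ : Pointℤ → Dir → Pointℤ
  (x , y , z) ⊹² X = (x + + 2 , y , z)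
  (x , y , z) ⊹² Y = (x , y + + 2 , z)
  (x , y , z) ⊹² Z = (x , y , z + + 2)
  β ⊹² W = β

  embed : Point → Pointℤ
  embed ⟨ x , y , z , _ ⟩ = (+ x , + y , + z)

  embed-⊹ : ∀ p A → embed (p ⊹ A) ≡ embed p ⊹ᶻ A
  embed-⊹ ⟨ x , y , z , _ ⟩ X = cong (λ t → (+ t , + y , + z)) (+-comm 1 x)
  embed-⊹ ⟨ x , y , z , _ ⟩ Y = cong (λ t → (+ x , + t , + z)) (+-comm 1 y)
  embed-⊹ ⟨ x , y , z , _ ⟩ Z = cong (λ t → (+ x , + y , + t)) (+-comm 1 z)
  embed-⊹ ⟨ x , y , z , _ ⟩ W = refl

  embed-⊹⊹ : ∀ p A B → embed (p ⊹ A ⊹ B) ≡ embed p ⊹ᶻ A ⊹ᶻ B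
  embed-⊹⊹ p A B = trans (embed-⊹ (p ⊹ A) B) (cong (_⊹ᶻ B) (embed-⊹ p A))

  embed-⊹² : ∀ p A → embed (p ⊹ A ⊹ A) ≡ embed p ⊹² A
  embed-⊹² ⟨ x , y , z , _ ⟩ X = cong (λ t → (+ t , + y , + z)) (+-comm 2 x)
  embed-⊹² ⟨ x , y , z , _ ⟩ Y = cong (λ t → (+ x , + t , + z)) (+-comm 2 y)
  embed-⊹² ⟨ x , y , z , _ ⟩ Z = cong (λ t → (+ x , + y , + t)) (+-comm 2 z)
  embed-⊹² ⟨ x , y , z , _ ⟩ W = refl

open IntegerCoordinates

module FromFaces (R : LinOrdAbGroup) (n : ℕ) (f : ℤ → ℤ → ℤ → LinOrdAbGroup.G R) where
  open import Data.Nat using (z≤n) renaming (_≤_ to _≤ℕ_)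
  open import Data.Nat.Properties using (m≤n⇒∃[o]m+o≡n; m≤m+n; ≤-trans; ≤-reflexive)
  open import Data.Integer using (+_; _+_; _-_; _≤_; +≤+)
  open import Data.Integer.Properties using (drop‿+≤+)
  open import Data.Integer.Tactic.RingSolver using (solve-∀)
  open LinOrdAbGroup R
  open OrderedGroupProperties R
  open Rhombi R

  f⟨_⟩ : Pointℤ → G
  f⟨ x , y , z ⟩ = f x y z

  InΔ⟨_⟩ : Pointℤ → Set
  InΔ⟨ x , y , z ⟩ = InΔ R n x y z

  F : Point → G
  F p = f⟨ embed p ⟩

  RhombusAt : Dir → Dir → Dir → Pointℤ → Set
  RhombusAt A B C β = f⟨ β ⊹² A ⟩ ⊕ f⟨ β ⊹ᶻ C ⊹ᶻ B ⟩ ≼ f⟨ β ⊹ᶻ A ⊹ᶻ B ⟩ ⊕ f⟨ β ⊹ᶻ C ⊹ᶻ A ⟩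

  module _ (b : Point) where
    private
      vertex : ∀ A B → F (b ⊹ A ⊹ B) ≡ f⟨ embed b ⊹ᶻ A ⊹ᶻ B ⟩
      vertex A B = cong f⟨_⟩ (embed-⊹⊹ b A B)

      double : ∀ A → F (b ⊹ A ⊹ A) ≡ f⟨ embed b ⊹² A ⟩
      double A = cong f⟨_⟩ (embed-⊹² b A)

    Rhombus⇒RhombusAt : ∀ A B C → Rhombus F A B C b → RhombusAt A B C (embed b)
    Rhombus⇒RhombusAt A B C r = ⊕≼⊕-cong (double A) (vertex C B) (vertex A B) (vertex C A) (−≼−⇒⊕≼⊕ r)

    RhombusAt⇒Rhombus : ∀ A B C → RhombusAt A B C (embed b) → Rhombus F A B C b
    RhombusAt⇒Rhombus A B C r =
      ⊕≼⊕⇒−≼− (⊕≼⊕-cong (sym (double A)) (sym (vertex C B)) (sym (vertex A B)) (sym (vertex C A)) r)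

    PolarizedAt-embed : MainDiagonalMax (λ A B → f⟨ embed b ⊹ᶻ A ⊹ᶻ B ⟩) → PolarizedAt F b
    PolarizedAt-embed = MainDiagonalMax-cong (λ A B → sym (vertex A B))

  embed∈Δ : ∀ p → size p ≤ℕ n → InΔ⟨ embed p ⟩
  embed∈Δ ⟨ x , y , z , w ⟩ s = +≤+ z≤n , +≤+ z≤n , +≤+ z≤n , +≤+ (≤-trans (m≤m+n _ w) s)

  vertex∈Δ : ∀ b → IsBase n b → ∀ A B → InΔ⟨ embed b ⊹ᶻ A ⊹ᶻ B ⟩
  vertex∈Δ b e A B =
    subst InΔ⟨_⟩ (embed-⊹⊹ b A B) (embed∈Δ (b ⊹ A ⊹ B) (≤-reflexive (trans (size-⊹⊹ b A B) e)))

  double∈Δ : ∀ b → IsBase n b → ∀ A → InΔ⟨ embed b ⊹² A ⟩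
  double∈Δ b e A =
    subst InΔ⟨_⟩ (embed-⊹² b A) (embed∈Δ (b ⊹ A ⊹ A) (≤-reflexive (trans (size-⊹⊹ b A A) e)))

  via-embed : ∀ {x y z} → + 0 ≤ x → + 0 ≤ y → + 0 ≤ z → + 2 + (x + y + z) ≤ + n →
         (P : Pointℤ → Set) → (∀ b → IsBase n b → P (embed b)) → P (x , y , z)
  via-embed (+≤+ {n = a} z≤n) (+≤+ {n = b} z≤n) (+≤+ {n = k} z≤n) s P h with m≤n⇒∃[o]m+o≡n (drop‿+≤+ s)
  ... | w , e = h ⟨ a , b , k , w ⟩ e

  x≥0 : ∀ {x y z} → InΔ R n x y z → + 0 ≤ x
  x≥0 = proj₁
  y≥0 : ∀ {x y z} → InΔ R n x y z → + 0 ≤ y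
  y≥0 = proj₁ ∘ proj₂
  z≥0 : ∀ {x y z} → InΔ R n x y z → + 0 ≤ z
  z≥0 = proj₁ ∘ proj₂ ∘ proj₂

  sum≤ : ∀ {x y z} → InΔ R n x y z → x + y + z ≤ + n
  sum≤ = proj₂ ∘ proj₂ ∘ proj₂

  private
    XY-sum : ∀ x y z → x + + 1 + (y + + 1) + z ≡ + 2 + (x + y + z)
    XY-sum = solve-∀
    YZ-sum : ∀ x y z → x + (y + + 1) + (z + + 1) ≡ + 2 + (x + y + z)
    YZ-sum = solve-∀
    XZ-sum : ∀ x y z → x + + 1 + y + (z + + 1) ≡ + 2 + (x + y + z)
    XZ-sum = solve-∀

  sum-XY : ∀ x y {z} → InΔ R n (x + + 1) (y + + 1) z → + 2 + (x + y + z) ≤ + n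
  sum-XY x y {z} p = subst (_≤ + n) (XY-sum x y z) (sum≤ p)

  sum-YZ : ∀ {x} y z → InΔ R n x (y + + 1) (z + + 1) → + 2 + (x + y + z) ≤ + n
  sum-YZ {x} y z p = subst (_≤ + n) (YZ-sum x y z) (sum≤ p)

  sum-XZ : ∀ x {y} z → InΔ R n (x + + 1) y (z + + 1) → + 2 + (x + y + z) ≤ + n
  sum-XZ x {y} z p = subst (_≤ + n) (XZ-sum x y z) (sum≤ p)

  private
    diagonal-ZZ : ∀ c i j → c - i - j ≡ c - (i + + 1) - (j + + 1) + + 2
    diagonal-ZZ = solve-∀
    diagonal-XZ : ∀ c i j → c - (i + + 1) - j ≡ c - (i + + 1) - (j + + 1) + + 1
    diagonal-XZ = solve-∀
    diagonal-YZ : ∀ c i j → c - i - (j + + 1) ≡ c - (i + + 1) - (j + + 1) + + 1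
    diagonal-YZ = solve-∀
    diagonal-XX : ∀ c i j → c - (i + + 2) - j ≡ c - (i + + 1) - (j + + 1)
    diagonal-XX = solve-∀
    diagonal-YY : ∀ c i j → c - i - (j + + 2) ≡ c - (i + + 1) - (j + + 1)
    diagonal-YY = solve-∀
    ceiling-base : ∀ i j k → + 2 + (i + j + k + + 0) - (i + + 1) - (j + + 1) ≡ k
    ceiling-base = solve-∀

  -- (i , j , z) is the base of the rhombi at (i, j) in the plane x + y + z = c; type-i, type-ii
  -- and type-iii are the rhombus inequalities (i)–(iii) of that plane.
  module DiagonalPlane (c : ℤ) {i j z : ℤ} (base : c - (i + + 1) - (j + + 1) ≡ z) where
    at-ZZ : c - i - j ≡ z + + 2
    at-ZZ = trans (diagonal-ZZ c i j) (cong (_+ + 2) base)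
    at-XZ : c - (i + + 1) - j ≡ z + + 1
    at-XZ = trans (diagonal-XZ c i j) (cong (_+ + 1) base)
    at-YZ : c - i - (j + + 1) ≡ z + + 1
    at-YZ = trans (diagonal-YZ c i j) (cong (_+ + 1) base)
    at-XX : c - (i + + 2) - j ≡ z
    at-XX = trans (diagonal-XX c i j) base
    at-YY : c - i - (j + + 2) ≡ z
    at-YY = trans (diagonal-YY c i j) base

    ∈-diagonal : ∀ {u v t} → c - u - v ≡ t → InΔ R n u v t → InΔ R n u v (c - u - v)
    ∈-diagonal e = subst (InΔ R n _ _) (sym e)

    type-i : RhombusAt Z X Y (i , j , z) ⇔
      (f i j (c - i - j) ⊕ f (i + + 1) (j + + 1) (c - (i + + 1) - (j + + 1))
        ≼ f (i + + 1) j (c - (i + + 1) - j) ⊕ f i (j + + 1) (c - i - (j + + 1)))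
    type-i = ⊕≼⊕-cong⇔ (cong (f i j) (sym at-ZZ)) (cong (f (i + + 1) (j + + 1)) (sym base))
                       (cong (f (i + + 1) j) (sym at-XZ)) (cong (f i (j + + 1)) (sym at-YZ))

    type-ii : RhombusAt X Z Y (i , j , z) ⇔
      (f i (j + + 1) (c - i - (j + + 1)) ⊕ f (i + + 2) j (c - (i + + 2) - j)
        ≼ f (i + + 1) j (c - (i + + 1) - j) ⊕ f (i + + 1) (j + + 1) (c - (i + + 1) - (j + + 1)))
    type-ii = ⊕≼⊕-swap-cong⇔ (cong (f (i + + 2) j) (sym at-XX)) (cong (f i (j + + 1)) (sym at-YZ))
                             (cong (f (i + + 1) j) (sym at-XZ)) (cong (f (i + + 1) (j + + 1)) (sym base))

    type-iii : RhombusAt Y Z X (i , j , z) ⇔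
      (f i (j + + 2) (c - i - (j + + 2)) ⊕ f (i + + 1) j (c - (i + + 1) - j)
        ≼ f i (j + + 1) (c - i - (j + + 1)) ⊕ f (i + + 1) (j + + 1) (c - (i + + 1) - (j + + 1)))
    type-iii = ⊕≼⊕-cong⇔ (cong (f i (j + + 2)) (sym at-YY)) (cong (f (i + + 1) j) (sym at-XZ))
                         (cong (f i (j + + 1)) (sym at-YZ)) (cong (f (i + + 1) (j + + 1)) (sym base))

  module _ (polarized : Polarized R n f) (ground : GroundConcave R n f) (ceiling : CeilingConcave R n f)
    where

    polarizedAt : ∀ b → IsBase n b → PolarizedAt F b
    polarizedAt b e = PolarizedAt-embed b (polarized _ _ _ (v X W) (v Y W) (v Z W) (v X Y) (v X Z) (v Y Z))
      where
      v : ∀ A B → InΔ⟨ embed b ⊹ᶻ A ⊹ᶻ B ⟩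
      v = vertex∈Δ b e

    ground-rhombi : ∀ i j l → IsBase n ⟨ i , j , 0 , l ⟩ →
      Rhombus F W X Y ⟨ i , j , 0 , l ⟩ × Rhombus F X W Y ⟨ i , j , 0 , l ⟩ ×
      Rhombus F Y W X ⟨ i , j , 0 , l ⟩
    ground-rhombi i j l e =
        RhombusAt⇒Rhombus b W X Y (proj₁ ground (+ i) (+ j) (v W W) (v X Y) (v X W) (v Y W))
      , RhombusAt⇒Rhombus b X W Y
          (⊕≼-swap (proj₁ (proj₂ ground) (+ i) (+ j) (v X W) (v X Y) (v Y W) (double∈Δ b e X)))
      , RhombusAt⇒Rhombus b Y W X
          (proj₂ (proj₂ ground) (+ i) (+ j) (v Y W) (v X Y) (double∈Δ b e Y) (v X W))
      where
      b : Point
      b = ⟨ i , j , 0 , l ⟩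
      v : ∀ A B → InΔ⟨ embed b ⊹ᶻ A ⊹ᶻ B ⟩
      v = vertex∈Δ b e

    ceiling-rhombi : ∀ i j k → IsBase n ⟨ i , j , k , 0 ⟩ →
      Rhombus F Z X Y ⟨ i , j , k , 0 ⟩ × Rhombus F X Z Y ⟨ i , j , k , 0 ⟩ ×
      Rhombus F Y Z X ⟨ i , j , k , 0 ⟩
    ceiling-rhombi i j k e =
        RhombusAt⇒Rhombus b Z X Y (from type-i (proj₁ ceiling (+ i) (+ j)
          (∈-diagonal at-ZZ (double∈Δ b e Z)) (∈-diagonal base (v X Y))
          (∈-diagonal at-XZ (v X Z)) (∈-diagonal at-YZ (v Y Z))))
      , RhombusAt⇒Rhombus b X Z Y (from type-ii (proj₁ (proj₂ ceiling) (+ i) (+ j)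
          (∈-diagonal at-XZ (v X Z)) (∈-diagonal base (v X Y))
          (∈-diagonal at-YZ (v Y Z)) (∈-diagonal at-XX (double∈Δ b e X))))
      , RhombusAt⇒Rhombus b Y Z X (from type-iii (proj₂ (proj₂ ceiling) (+ i) (+ j)
          (∈-diagonal at-YZ (v Y Z)) (∈-diagonal base (v X Y))
          (∈-diagonal at-YY (double∈Δ b e Y)) (∈-diagonal at-XZ (v X Z))))
      where
      b : Point
      b = ⟨ i , j , k , 0 ⟩
      v : ∀ A B → InΔ⟨ embed b ⊹ᶻ A ⊹ᶻ B ⟩
      v = vertex∈Δ b e
      base : + n - (+ i + + 1) - (+ j + + 1) ≡ + k
      base = trans (cong (λ t → + t - (+ i + + 1) - (+ j + + 1)) (sym e)) (ceiling-base (+ i) (+ j) (+ k))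
      open DiagonalPlane (+ n) {+ i} {+ j} base
      open Equivalence

    open Concavity n F polarizedAt ground-rhombi ceiling-rhombi

    rhombusAt : ∀ A B C → (∀ b → IsBase n b → Rhombus F A B C b) →
                ∀ {x y z} → + 0 ≤ x → + 0 ≤ y → + 0 ≤ z → + 2 + (x + y + z) ≤ + n →
                RhombusAt A B C (x , y , z)
    rhombusAt A B C r 0≤x 0≤y 0≤z s =
      via-embed 0≤x 0≤y 0≤z s (RhombusAt A B C) (λ b e → Rhombus⇒RhombusAt b A B C (r b e))

    z-plane : ∀ c → DConcave2 R (λ x y → InΔ R n x y c) (λ x y → f x y c)
    z-plane c =
        (λ i j p q _ _ → rhombusAt W X Y rhombus-WXY (x≥0 p) (y≥0 p) (z≥0 p) (sum-XY i j q))
      , (λ i j p q r _ → ⊕≼-swap (rhombusAt X W Y rhombus-XWY (x≥0 r) (y≥0 p) (z≥0 p) (sum-XY i j q)))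
      , (λ i j p q _ r → rhombusAt Y W X rhombus-YWX (x≥0 p) (y≥0 r) (z≥0 p) (sum-XY i j q))

    x-plane : ∀ c → DConcave2 R (λ y z → InΔ R n c y z) (λ y z → f c y z)
    x-plane c =
        (λ i j p q _ _ → rhombusAt W Y Z rhombus-WYZ (x≥0 p) (y≥0 p) (z≥0 p) (sum-YZ i j q))
      , (λ i j p q r _ → ⊕≼-swap (rhombusAt Y W Z rhombus-YWZ (x≥0 p) (y≥0 r) (z≥0 p) (sum-YZ i j q)))
      , (λ i j p q _ r → rhombusAt Z W Y rhombus-ZWY (x≥0 p) (y≥0 p) (z≥0 r) (sum-YZ i j q))

    y-plane : ∀ c → DConcave2 R (λ x z → InΔ R n x c z) (λ x z → f x c z)
    y-plane c =
        (λ i j p q _ _ → rhombusAt W X Z rhombus-WXZ (x≥0 p) (y≥0 p) (z≥0 p) (sum-XZ i j q))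
      , (λ i j p q r _ → ⊕≼-swap (rhombusAt X W Z rhombus-XWZ (x≥0 r) (y≥0 p) (z≥0 p) (sum-XZ i j q)))
      , (λ i j p q _ r → rhombusAt Z W X rhombus-ZWX (x≥0 p) (y≥0 p) (z≥0 r) (sum-XZ i j q))

    diagonal-plane : ∀ c → DConcave2 R (λ x y → InΔ R n x y (c - x - y)) (λ x y → f x y (c - x - y))
    diagonal-plane c =
        (λ i j p q _ _ → to (type-i c {i} {j} refl)
                            (rhombusAt Z X Y rhombus-ZXY (x≥0 p) (y≥0 p) (z≥0 q) (sum-XY i j q)))
      , (λ i j p q r _ → to (type-ii c {i} {j} refl)
                            (rhombusAt X Z Y rhombus-XZY (x≥0 r) (y≥0 p) (z≥0 q) (sum-XY i j q)))
      , (λ i j p q _ r → to (type-iii c {i} {j} refl)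
                            (rhombusAt Y Z X rhombus-YZX (x≥0 p) (y≥0 r) (z≥0 q) (sum-XY i j q)))
      where
      open Equivalence
      open DiagonalPlane using (type-i; type-ii; type-iii)

    pcpm : PCPM R n f
    pcpm = polarized , λ c → z-plane c , x-plane c , y-plane c , diagonal-plane c

mainTheorem1 : (R : LinOrdAbGroup) (n : ℕ) → n ≥ 1 →
    (f : ℤ → ℤ → ℤ → LinOrdAbGroup.G R) →
    Polarized R n f → GroundConcave R n f → CeilingConcave R n f →
    PCPM R n f
mainTheorem1 R n _ f = FromFaces.pcpm R n f
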